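{- Let $t\ge 2$, $m\ge1$ and $n$ be positive integers with $n>t^m$. Then the set $\{1,t,t^2,\dots,t^{m-1}\}$ is a $t$-free set of size $m$ in $\mathbb{Z}_n$. Consequently, $s(\mathbb{Z}_n,t)\ge \lfloor \log_t(n-1)\rfloor$ for every integer $n\ge 2$.
   Context: For an abelian group $G$ (written additively) and a positive integer $t$, a subset $S\subseteq G$ is $t$-free if for all non-negative integers $k,l$ with $k+l\le t$, a sum of $k$ (not necessarily distinct) elements of $S$ equals a sum of $l$ (not necessarily distinct) elements of $S$ only if $k=l$ and the two sums consist of the same terms (as multisets). Equivalently, every equation $\epsilon_1x_1+\cdots+\epsilon_tx_t=0$ with $\epsilon_i\in\{0,1,-1\}$ has only trivial solutions in $S$ (after cancelling any element appearing with both coefficients $+1$ and $-1$, all coefficients vanish). $s(G,t)$ denotes the maximum cardinality of a $t$-free set in $G$; $\mathbb{Z}_n$ is the cyclic group of order $n$. -}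

module Defs where

open import Data.Nat using (ℕ; zero; suc; _+_; _*_; _^_; _≤_; _<_; _∸_; NonZero)
open import Data.Nat.Properties using (_≤?_)
open import Data.Fin using (Fin; toℕ) renaming (zero to fzero; suc to fsuc)
open import Data.Integer as ℤ using (ℤ; +_)
open import Data.Integer.Divisibility using () renaming (_∣_ to _∣ℤ_)
open import Data.List using (List; length; map)
open import Data.List.Membership.Propositional using (_∈_)
open import Data.List.Relation.Unary.Unique.Propositional using (Unique)
open import Relation.Binary.PropositionalEquality using (_≡_)
open import Relation.Nullary using (yes; no)
open import Relation.Nullary.Decidable using (⌊_⌋)
open import Data.Fin using (_≟_)
open import Data.Bool using (if_then_else_)
open import Data.Product using (Σ; _×_)

data Sign : Set where
  zer pos neg : Sign

⟦_⟧ : Sign → ℤ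
⟦ zer ⟧ = + 0
⟦ pos ⟧ = ℤ.+ 1
⟦ neg ⟧ = ℤ.- (+ 1)

Σℤ : (t : ℕ) → (Fin t → ℤ) → ℤ
Σℤ zero    f = + 0
Σℤ (suc t) f = f fzero ℤ.+ Σℤ t (λ i → f (fsuc i))

-- The cyclic group ℤ_n is modelled by residues Fin n (representatives 0..n-1);
-- an element x ∈ ℤ_n is identified with its representative toℕ x.
-- The equation ε₁x₁+⋯+ε_t x_t = 0 holds in ℤ_n iff n divides the integer sum
-- of representatives.
SumZeroMod : (n t : ℕ) → (Fin t → Sign) → (Fin t → Fin n) → Set
SumZeroMod n t ε x = (+ n) ∣ℤ Σℤ t (λ i → ⟦ ε i ⟧ ℤ.* (+ toℕ (x i)))

netCoeff : ∀ {n} t → (Fin t → Sign) → (Fin t → Fin n) → Fin n → ℤ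
netCoeff t ε x s = Σℤ t (λ i → if ⌊ x i ≟ s ⌋ then ⟦ ε i ⟧ else + 0)

-- S ⊆ ℤ_n (given as a duplicate-free list) is t-free: every equation
-- ε₁x₁+⋯+ε_t x_t = 0 with ε_i ∈ {0,1,-1} and x_i ∈ S is trivial, i.e.
-- after cancellation all coefficients vanish.
IsTFree : (n t : ℕ) → List (Fin n) → Set
IsTFree n t S =
  Unique S ×
  ((ε : Fin t → Sign) (x : Fin t → Fin n) → (∀ i → x i ∈ S) →
    SumZeroMod n t ε x → ∀ s → netCoeff t ε x s ≡ + 0)

-- "s(ℤ_n, t) ≥ k": there is a t-free set in ℤ_n with at least k elements.
-- (s is the maximum size of a t-free set, so s ≥ k iff such a set exists.)
sZn≥ : (n t k : ℕ) → Set
sZn≥ n t k = Σ (List (Fin n)) λ S → IsTFree n t S × k ≤ length S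

IsFloorLog : (t N k : ℕ) → Set
IsFloorLog t N k = (t ^ k ≤ N) × (N < t ^ suc k)

-- An equation ε₁x₁ + ⋯ + ε_t x_t = 0 with every x_i = t^(a_i), 0 ≤ a_i < m,
-- has integer left-hand side of absolute value at most t · t^(m-1) < n; so if it
-- holds modulo n it holds in ℤ.  The heart of the proof is then a uniqueness
-- statement for base-t expansions: if a signed sum Σ ε_i t^(a_i) of weight
-- Σ |ε_i| ≤ t vanishes, then for every j the net coefficient of t^j (the sum
-- of the ε_i with a_i = j) vanishes.  This is shown by induction on j:
-- splitting off the terms with a_i = 0 writes the sum as t·Q + C with
-- |C| ≤ U, where U is the weight of those terms; t|Q| = |C| ≤ U ≤ t forces
-- Q = 0 (either U < t, or Q has weight 0), hence C = 0, and
-- the coefficient of t^(j+1) in the original sum is that of t^j in Q.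
module Submission where

open import Defs
import Algebra.Properties.Semiring.Sum as SemiringSum
open import Algebra.Bundles using (AbelianGroup)
open import Data.Bool using (true; false; if_then_else_)
open import Data.Fin as Fin using (Fin; toℕ; fromℕ<) renaming (zero to fzero; suc to fsuc)
import Data.Fin.Properties as FinP
open import Data.Integer as ℤ using (ℤ; +_; ∣_∣)
import Data.Integer.Properties as ℤP
open import Data.Integer.Divisibility using () renaming (_∣_ to _∣ℤ_)
open import Data.List using (List; []; _∷_; length; map; upTo)
import Data.List.Properties as ListP
open import Data.List.Membership.Propositional using (_∈_)
import Data.List.Membership.Propositional.Properties as ∈P
open import Data.List.Relation.Unary.All using (All; []; _∷_)
import Data.List.Relation.Unary.All.Properties as AllP
open import Data.List.Relation.Unary.Unique.Propositional using (Unique)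
import Data.List.Relation.Unary.Unique.Propositional.Properties as UniqueP
open import Data.Nat as ℕ using (ℕ; zero; suc; pred; _^_; _≤_; _<_; _∸_; z≤n; s≤s)
open import Data.Nat.Divisibility using (>⇒∤)
open import Data.Nat.Properties
open import Data.Product using (Σ; _×_; _,_; proj₁; proj₂)
open import Function using (_∘_; id; _⇔_; mk⇔)
open import Relation.Binary.Definitions using (tri<; tri≈; tri>)
open import Relation.Binary.PropositionalEquality
open import Relation.Nullary using (Dec; yes; no; contradiction)
open import Relation.Nullary.Decidable using (⌊_⌋; isYes≗does; does-⇔)

open import Algebra.Properties.Group (AbelianGroup.group ℤP.+-0-abelianGroup)
  using (inverseʳ-unique)

module ℤΣ = SemiringSum ℤP.+-*-semiring
module ℕΣ = SemiringSum +-*-semiring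
open ℤΣ using () renaming (sum to sumℤ)
open ℕΣ using () renaming (sum to sumℕ)

Σℤ≡sumℤ : ∀ T (f : Fin T → ℤ) → Σℤ T f ≡ sumℤ f
Σℤ≡sumℤ zero    f = refl
Σℤ≡sumℤ (suc T) f = cong (λ s → f fzero ℤ.+ s) (Σℤ≡sumℤ T (f ∘ fsuc))

∣sumℤ∣≤ : ∀ {T} (f : Fin T → ℤ) → ∣ sumℤ f ∣ ≤ sumℕ (∣_∣ ∘ f)
∣sumℤ∣≤ {zero}  f = z≤n
∣sumℤ∣≤ {suc T} f = ≤-trans (ℤP.∣i+j∣≤∣i∣+∣j∣ (f fzero) _)
                             (+-monoʳ-≤ ∣ f fzero ∣ (∣sumℤ∣≤ (f ∘ fsuc)))

sumℤ-zero : ∀ {T} {f : Fin T → ℤ} → (∀ i → f i ≡ + 0) → sumℤ f ≡ + 0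
sumℤ-zero {T} f≡0 = trans (ℤΣ.sum-cong-≗ f≡0) (ℤΣ.sum-replicate-zero T)

sumℕ-mono : ∀ {T} {f g : Fin T → ℕ} → (∀ i → f i ≤ g i) → sumℕ f ≤ sumℕ g
sumℕ-mono {zero}  f≤g = z≤n
sumℕ-mono {suc T} f≤g = +-mono-≤ (f≤g fzero) (sumℕ-mono (f≤g ∘ fsuc))

sumℕ≤count : ∀ {T} (f : Fin T → ℕ) → (∀ i → f i ≤ 1) → sumℕ f ≤ T
sumℕ≤count {zero}  f f≤1 = z≤n
sumℕ≤count {suc T} f f≤1 = +-mono-≤ (f≤1 fzero) (sumℕ≤count (f ∘ fsuc) (f≤1 ∘ fsuc))

sumℕ≡0⇒≡0 : ∀ {T} (f : Fin T → ℕ) → sumℕ f ≡ 0 → ∀ i → f i ≡ 0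
sumℕ≡0⇒≡0 f sum≡0 fzero    = m+n≡0⇒m≡0 (f fzero) sum≡0
sumℕ≡0⇒≡0 f sum≡0 (fsuc i) = sumℕ≡0⇒≡0 (f ∘ fsuc) (m+n≡0⇒n≡0 (f fzero) sum≡0) i

⌊⌋-⇔ : {A B : Set} → A ⇔ B → (a? : Dec A) (b? : Dec B) → ⌊ a? ⌋ ≡ ⌊ b? ⌋
⌊⌋-⇔ A⇔B a? b? = trans (isYes≗does a?) (trans (does-⇔ A⇔B a? b?) (sym (isYes≗does b?)))

^-injective : ∀ {t} → 2 ≤ t → ∀ {k l} → t ^ k ≡ t ^ l → k ≡ l
^-injective {t} t≥2 {k} {l} t^k≡t^l with <-cmp k l
... | tri< k<l _ _ = contradiction t^k≡t^l (<⇒≢ (^-monoʳ-< t t≥2 k<l))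
... | tri≈ _ k≡l _ = k≡l
... | tri> _ _ l<k = contradiction (sym t^k≡t^l) (<⇒≢ (^-monoʳ-< t t≥2 l<k))

small-multiple≡0 : ∀ {n} (z : ℤ) → (+ n) ∣ℤ z → ∣ z ∣ < n → z ≡ + 0
small-multiple≡0 z n∣z z<n with ∣ z ∣ in ∣z∣≡
... | zero  = ℤP.∣i∣≡0⇒i≡0 ∣z∣≡
... | suc _ = contradiction n∣z (>⇒∤ z<n)

∣⟦⟧∣≤1 : ∀ e → ∣ ⟦ e ⟧ ∣ ≤ 1
∣⟦⟧∣≤1 zer = z≤n
∣⟦⟧∣≤1 pos = s≤s z≤n
∣⟦⟧∣≤1 neg = s≤s z≤n

digitTerm : ℕ → Sign → ℕ → ℤ
digitTerm k e j = if ⌊ k ℕ.≟ j ⌋ then ⟦ e ⟧ else + 0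

powerSum : ℕ → ∀ {T} → (Fin T → Sign) → (Fin T → ℕ) → ℤ
powerSum t ε a = sumℤ (λ i → ⟦ ε i ⟧ ℤ.* + (t ^ a i))

coeff : ∀ {T} → (Fin T → Sign) → (Fin T → ℕ) → ℕ → ℤ
coeff ε a j = sumℤ (λ i → digitTerm (a i) (ε i) j)

weight : ∀ {T} → (Fin T → Sign) → ℕ
weight ε = sumℕ (λ i → ∣ ⟦ ε i ⟧ ∣)

weight≤count : ∀ {T} (ε : Fin T → Sign) → weight ε ≤ T
weight≤count ε = sumℕ≤count _ (∣⟦⟧∣≤1 ∘ ε)

weight≡0⇒powerSum≡0 : ∀ t {T} (ε : Fin T → Sign) a → weight ε ≡ 0 → powerSum t ε a ≡ + 0
weight≡0⇒powerSum≡0 t ε a weight≡0 =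
  sumℤ-zero (λ i → unused (ε i) (sumℕ≡0⇒≡0 _ weight≡0 i))
  where
  unused : ∀ {p} e → ∣ ⟦ e ⟧ ∣ ≡ 0 → ⟦ e ⟧ ℤ.* p ≡ + 0
  unused zer _ = refl

∣powerSum∣≤ : ∀ t {T} (ε : Fin T → Sign) a P → (∀ i → t ^ a i ≤ P) →
              ∣ powerSum t ε a ∣ ≤ weight ε ℕ.* P
∣powerSum∣≤ t ε a P t^a≤P =
  ≤-trans (∣sumℤ∣≤ (λ i → ⟦ ε i ⟧ ℤ.* + (t ^ a i)))
          (≤-trans (sumℕ-mono term≤) (≤-reflexive (sym (ℕΣ.*-distribʳ-sum P (λ i → ∣ ⟦ ε i ⟧ ∣)))))
  where
  term≤ : ∀ i → ∣ ⟦ ε i ⟧ ℤ.* + (t ^ a i) ∣ ≤ ∣ ⟦ ε i ⟧ ∣ ℕ.* P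
  term≤ i = ≤-trans (≤-reflexive (ℤP.∣i*j∣≡∣i∣*∣j∣ ⟦ ε i ⟧ _)) (*-monoʳ-≤ ∣ ⟦ ε i ⟧ ∣ (t^a≤P i))

-- The sign of e·t^k in the quotient by t: a term with k = 0 is left in the
-- remainder, every other term e·t^k becomes e·t^(k-1).
quotSign : ℕ → Sign → Sign
quotSign zero    e = zer
quotSign (suc _) e = e

term-split : ∀ t k e →
  ⟦ e ⟧ ℤ.* + (t ^ k) ≡ + t ℤ.* (⟦ quotSign k e ⟧ ℤ.* + (t ^ pred k)) ℤ.+ digitTerm k e 0
term-split t zero e = begin
  ⟦ e ⟧ ℤ.* + 1                ≡⟨ ℤP.*-identityʳ ⟦ e ⟧ ⟩
  ⟦ e ⟧                        ≡⟨ ℤP.+-identityˡ ⟦ e ⟧ ⟨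
  + 0 ℤ.+ ⟦ e ⟧                ≡⟨ cong (ℤ._+ ⟦ e ⟧) (ℤP.*-zeroʳ (+ t)) ⟨
  + t ℤ.* + 0 ℤ.+ ⟦ e ⟧        ∎
  where open ≡-Reasoning
term-split t (suc k) e = begin
  ⟦ e ⟧ ℤ.* + (t ℕ.* t ^ k)            ≡⟨ cong (⟦ e ⟧ ℤ.*_) (ℤP.pos-* t (t ^ k)) ⟩
  ⟦ e ⟧ ℤ.* (+ t ℤ.* + (t ^ k))        ≡⟨ ℤP.*-assoc ⟦ e ⟧ (+ t) _ ⟨
  ⟦ e ⟧ ℤ.* + t ℤ.* + (t ^ k)          ≡⟨ cong (ℤ._* + (t ^ k)) (ℤP.*-comm ⟦ e ⟧ (+ t)) ⟩
  + t ℤ.* ⟦ e ⟧ ℤ.* + (t ^ k)          ≡⟨ ℤP.*-assoc (+ t) ⟦ e ⟧ _ ⟩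
  + t ℤ.* (⟦ e ⟧ ℤ.* + (t ^ k))        ≡⟨ ℤP.+-identityʳ _ ⟨
  + t ℤ.* (⟦ e ⟧ ℤ.* + (t ^ k)) ℤ.+ + 0 ∎
  where open ≡-Reasoning

term-weight : ∀ k e → ∣ ⟦ e ⟧ ∣ ≡ ∣ digitTerm k e 0 ∣ ℕ.+ ∣ ⟦ quotSign k e ⟧ ∣
term-weight zero    zer = refl
term-weight zero    pos = refl
term-weight zero    neg = refl
term-weight (suc k) e   = refl

term-shift : ∀ k e j → digitTerm k e (suc j) ≡ digitTerm (pred k) (quotSign k e) j
term-shift zero e j with ⌊ 0 ℕ.≟ j ⌋
... | true  = refl
... | false = refl
term-shift (suc k) e j =
  cong (if_then ⟦ e ⟧ else + 0) (⌊⌋-⇔ (mk⇔ suc-injective (cong suc)) (suc k ℕ.≟ suc j) (k ℕ.≟ j))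

quotExps : ∀ {T} → (Fin T → ℕ) → Fin T → ℕ
quotExps a i = pred (a i)

module _ {T : ℕ} (ε : Fin T → Sign) (a : Fin T → ℕ) where

  quotSigns : Fin T → Sign
  quotSigns i = quotSign (a i) (ε i)

  unitWeight : ℕ
  unitWeight = sumℕ (λ i → ∣ digitTerm (a i) (ε i) 0 ∣)

  powerSum-split : ∀ t →
    powerSum t ε a ≡ + t ℤ.* powerSum t quotSigns (quotExps a) ℤ.+ coeff ε a 0
  powerSum-split t = begin
    powerSum t ε a
      ≡⟨ ℤΣ.sum-cong-≗ (λ i → term-split t (a i) (ε i)) ⟩
    sumℤ (λ i → + t ℤ.* quotTerm i ℤ.+ unitTerm i)
      ≡⟨ ℤΣ.∑-distrib-+ (λ i → + t ℤ.* quotTerm i) unitTerm ⟩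
    sumℤ (λ i → + t ℤ.* quotTerm i) ℤ.+ coeff ε a 0
      ≡⟨ cong (ℤ._+ coeff ε a 0) (ℤΣ.*-distribˡ-sum (+ t) quotTerm) ⟨
    + t ℤ.* powerSum t quotSigns (quotExps a) ℤ.+ coeff ε a 0
      ∎
    where
    open ≡-Reasoning
    quotTerm unitTerm : Fin T → ℤ
    quotTerm i = ⟦ quotSigns i ⟧ ℤ.* + (t ^ quotExps a i)
    unitTerm i = digitTerm (a i) (ε i) 0

  weight-split : weight ε ≡ unitWeight ℕ.+ weight quotSigns
  weight-split = trans (ℕΣ.sum-cong-≗ (λ i → term-weight (a i) (ε i)))
                       (ℕΣ.∑-distrib-+ (λ i → ∣ digitTerm (a i) (ε i) 0 ∣) (λ i → ∣ ⟦ quotSigns i ⟧ ∣))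

  ∣coeff₀∣≤unitWeight : ∣ coeff ε a 0 ∣ ≤ unitWeight
  ∣coeff₀∣≤unitWeight = ∣sumℤ∣≤ (λ i → digitTerm (a i) (ε i) 0)

  coeff-shift : ∀ j → coeff ε a (suc j) ≡ coeff quotSigns (quotExps a) j
  coeff-shift j = ℤΣ.sum-cong-≗ (λ i → term-shift (a i) (ε i) j)

vanishing-step : ∀ t {T} (ε : Fin T → Sign) a → weight ε ≤ t → powerSum t ε a ≡ + 0 →
                 powerSum t (quotSigns ε a) (quotExps a) ≡ + 0 × coeff ε a 0 ≡ + 0
vanishing-step t ε a weight≤t sum≡0 = Q≡0 , C≡0
  where
  Q C : ℤ
  Q = powerSum t (quotSigns ε a) (quotExps a)
  C = coeff ε a 0
  U : ℕ
  U = unitWeight ε a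

  C≡-tQ : C ≡ ℤ.- (+ t ℤ.* Q)
  C≡-tQ = inverseʳ-unique (+ t ℤ.* Q) C
            (trans (sym (powerSum-split ε a t)) sum≡0)

  t∣Q∣≤U : t ℕ.* ∣ Q ∣ ≤ U
  t∣Q∣≤U = begin
    t ℕ.* ∣ Q ∣          ≡⟨ ℤP.∣i*j∣≡∣i∣*∣j∣ (+ t) Q ⟨
    ∣ + t ℤ.* Q ∣        ≡⟨ ℤP.∣-i∣≡∣i∣ (+ t ℤ.* Q) ⟨
    ∣ ℤ.- (+ t ℤ.* Q) ∣  ≡⟨ cong ∣_∣ C≡-tQ ⟨
    ∣ C ∣                ≤⟨ ∣coeff₀∣≤unitWeight ε a ⟩
    U                    ∎
    where open ≤-Reasoning

  U+W′≤t : U ℕ.+ weight (quotSigns ε a) ≤ t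
  U+W′≤t = subst (_≤ t) (weight-split ε a) weight≤t

  -- Either the quotient uses no term, or U < t and then t·|Q| < t.
  Q≡0 : Q ≡ + 0
  Q≡0 with weight (quotSigns ε a) in W′≡
  ... | zero  = weight≡0⇒powerSum≡0 t (quotSigns ε a) (quotExps a) W′≡
  ... | suc w = ℤP.∣i∣≡0⇒i≡0 (n<1⇒n≡0 (*-cancelˡ-< t ∣ Q ∣ 1 t∣Q∣<t·1))
    where
    t∣Q∣<t·1 : t ℕ.* ∣ Q ∣ < t ℕ.* 1
    t∣Q∣<t·1 = begin-strict
      t ℕ.* ∣ Q ∣   ≤⟨ t∣Q∣≤U ⟩
      U             <⟨ m<m+n U (s≤s z≤n) ⟩
      U ℕ.+ suc w   ≤⟨ subst (λ W → U ℕ.+ W ≤ t) W′≡ U+W′≤t ⟩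
      t             ≡⟨ *-identityʳ t ⟨
      t ℕ.* 1       ∎
      where open ≤-Reasoning

  C≡0 : C ≡ + 0
  C≡0 = trans C≡-tQ (trans (cong (λ q → ℤ.- (+ t ℤ.* q)) Q≡0) (cong ℤ.-_ (ℤP.*-zeroʳ (+ t))))

vanishing⇒coeff≡0 : ∀ t {T} (ε : Fin T → Sign) a → weight ε ≤ t → powerSum t ε a ≡ + 0 →
                    ∀ j → coeff ε a j ≡ + 0
vanishing⇒coeff≡0 t ε a weight≤t sum≡0 zero    = proj₂ (vanishing-step t ε a weight≤t sum≡0)
vanishing⇒coeff≡0 t ε a weight≤t sum≡0 (suc j) =
  trans (coeff-shift ε a j)
        (vanishing⇒coeff≡0 t (quotSigns ε a) (quotExps a) weight′≤t
                           (proj₁ (vanishing-step t ε a weight≤t sum≡0)) j)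
  where
  weight′≤t : weight (quotSigns ε a) ≤ t
  weight′≤t = ≤-trans (m≤n+m _ (unitWeight ε a)) (subst (_≤ t) (weight-split ε a) weight≤t)

-- netCoeff only sees which x_i equal s; relabelling the x_i by exponents
-- a_i with x_i = s ⇔ a_i = j turns it into the coefficient of t^j.
netCoeff≡coeff : ∀ {n T} (ε : Fin T → Sign) (x : Fin T → Fin n) s a j →
                 (∀ i → (x i ≡ s) ⇔ (a i ≡ j)) → netCoeff T ε x s ≡ coeff ε a j
netCoeff≡coeff {T = T} ε x s a j same = trans (Σℤ≡sumℤ T _) (ℤΣ.sum-cong-≗ λ i →
  cong (if_then ⟦ ε i ⟧ else + 0) (⌊⌋-⇔ (same i) (x i Fin.≟ s) (a i ℕ.≟ j)))

toResidues : ∀ {n} {l : List ℕ} → All (_< n) l → List (Fin n)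
toResidues []       = []
toResidues (p ∷ ps) = fromℕ< p ∷ toResidues ps

toℕ-toResidues : ∀ {n} {l : List ℕ} (ps : All (_< n) l) → map toℕ (toResidues ps) ≡ l
toℕ-toResidues []       = refl
toℕ-toResidues (p ∷ ps) = cong₂ _∷_ (FinP.toℕ-fromℕ< p) (toℕ-toResidues ps)

powers-tFree : ∀ {t m n} → 2 ≤ t → 1 ≤ m → t ^ m < n → (S : List (Fin n)) →
               map toℕ S ≡ map (t ^_) (upTo m) → IsTFree n t S
powers-tFree {t@(suc _)} {suc m} {n} t≥2 _ t^m<n S S≡powers = unique , free
  where
  unique : Unique S
  unique = UniqueP.map⁻ (subst Unique (sym S≡powers)
                          (UniqueP.map⁺ (^-injective t≥2) (UniqueP.upTo⁺ (suc m))))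

  exponentOf : ∀ {y} → y ∈ S → Σ ℕ λ k → k < suc m × toℕ y ≡ t ^ k
  exponentOf y∈S with ∈P.∈-map⁻ (t ^_) (subst (_ ∈_) S≡powers (∈P.∈-map⁺ toℕ y∈S))
  ... | k , k∈upTo , y≡t^k = k , ∈P.∈-upTo⁻ k∈upTo , y≡t^k

  free : (ε : Fin t → Sign) (x : Fin t → Fin n) → (∀ i → x i ∈ S) →
         SumZeroMod n t ε x → ∀ s → netCoeff t ε x s ≡ + 0
  free ε x x∈S n∣sum s = netCoeff≡0
    where
    a : Fin t → ℕ
    a i = proj₁ (exponentOf (x∈S i))

    x≡t^a : ∀ i → toℕ (x i) ≡ t ^ a i
    x≡t^a i = proj₂ (proj₂ (exponentOf (x∈S i)))

    sum≡powerSum : Σℤ t (λ i → ⟦ ε i ⟧ ℤ.* + toℕ (x i)) ≡ powerSum t ε a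
    sum≡powerSum = trans (Σℤ≡sumℤ t (λ i → ⟦ ε i ⟧ ℤ.* + toℕ (x i)))
                         (ℤΣ.sum-cong-≗ λ i → cong (λ y → ⟦ ε i ⟧ ℤ.* + y) (x≡t^a i))

    ∣powerSum∣<n : ∣ powerSum t ε a ∣ < n
    ∣powerSum∣<n = begin-strict
      ∣ powerSum t ε a ∣   ≤⟨ ∣powerSum∣≤ t ε a (t ^ m) (λ i →
                                 ^-monoʳ-≤ t (≤-pred (proj₁ (proj₂ (exponentOf (x∈S i)))))) ⟩
      weight ε ℕ.* t ^ m   ≤⟨ *-monoˡ-≤ (t ^ m) (weight≤count ε) ⟩
      t ^ suc m            <⟨ t^m<n ⟩
      n                    ∎
      where open ≤-Reasoning

    -- Small enough to vanish in ℤ, not just modulo n.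
    powerSum≡0 : powerSum t ε a ≡ + 0
    powerSum≡0 = small-multiple≡0 _ (subst ((+ n) ∣ℤ_) sum≡powerSum n∣sum) ∣powerSum∣<n

    coeff≡0 : ∀ j → coeff ε a j ≡ + 0
    coeff≡0 = vanishing⇒coeff≡0 t ε a (weight≤count ε) powerSum≡0

    -- s is x_{i₀} for some i₀, or not among the x_i (then use the unused exponent m + 1).
    netCoeff≡0 : netCoeff t ε x s ≡ + 0
    netCoeff≡0 with FinP.any? (λ i → x i Fin.≟ s)
    ... | yes (i₀ , xi₀≡s) = trans (netCoeff≡coeff ε x s a (a i₀) same) (coeff≡0 (a i₀))
      where
      same : ∀ i → (x i ≡ s) ⇔ (a i ≡ a i₀)
      same i = mk⇔
        (λ xi≡s → ^-injective t≥2
          (trans (sym (x≡t^a i)) (trans (cong toℕ (trans xi≡s (sym xi₀≡s))) (x≡t^a i₀))))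
        (λ ai≡ai₀ → trans (FinP.toℕ-injective
          (trans (x≡t^a i) (trans (cong (t ^_) ai≡ai₀) (sym (x≡t^a i₀))))) xi₀≡s)
    ... | no s∉x = trans (netCoeff≡coeff ε x s a (suc m) same) (coeff≡0 (suc m))
      where
      same : ∀ i → (x i ≡ s) ⇔ (a i ≡ suc m)
      same i = mk⇔ (λ xi≡s → contradiction (i , xi≡s) s∉x)
                   (λ ai≡m → contradiction ai≡m (<⇒≢ (proj₁ (proj₂ (exponentOf (x∈S i))))))

-- The empty set is t-free (for t ≥ 1 an equation always mentions an element).
empty-tFree : ∀ {n t} → 1 ≤ t → IsTFree n t []
empty-tFree {t = suc t} _ = Unique.[] , λ ε x x∈[] → contradiction (x∈[] fzero) λ ()

powers-freeSet : (t m n : ℕ) → 2 ≤ t → 1 ≤ m → t ^ m < n →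
                 Σ (List (Fin n)) λ S →
                   (map toℕ S ≡ map (t ^_) (upTo m)) × IsTFree n t S × length S ≡ m
powers-freeSet t m n t≥2 m≥1 t^m<n =
  S , toℕ-toResidues powers<n , powers-tFree t≥2 m≥1 t^m<n S (toℕ-toResidues powers<n) , length-S
  where
  powers<n : All (_< n) (map (t ^_) (upTo m))
  powers<n = AllP.map⁺ (AllP.applyUpTo⁺₁ id m λ k<m → <-trans (^-monoʳ-< t t≥2 k<m) t^m<n)

  S : List (Fin n)
  S = toResidues powers<n

  length-S : length S ≡ m
  length-S = begin
    length S                          ≡⟨ ListP.length-map toℕ S ⟨
    length (map toℕ S)                ≡⟨ cong length (toℕ-toResidues powers<n) ⟩
    length (map (t ^_) (upTo m))      ≡⟨ ListP.length-map (t ^_) (upTo m) ⟩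
    length (upTo m)                   ≡⟨ ListP.length-upTo m ⟩
    m                                 ∎
    where open ≡-Reasoning

floorLog-freeSet : (t n k : ℕ) → 2 ≤ t → 2 ≤ n → IsFloorLog t (n ∸ 1) k → sZn≥ n t k
floorLog-freeSet t n zero t≥2 _ _ = [] , empty-tFree (≤-trans (n≤1+n 1) t≥2) , z≤n
floorLog-freeSet t (suc n) (suc k) t≥2 _ (t^k≤n , _) =
  let (S , _ , S-free , length-S) = powers-freeSet t (suc k) (suc n) t≥2 (s≤s z≤n) (s≤s t^k≤n)
  in  S , S-free , ≤-reflexive (sym length-S)

proposition10 :
    ((t m n : ℕ) → 2 ≤ t → 1 ≤ m → (t ^ m < n) →
      Σ (List (Fin n)) λ S →
        (map toℕ S ≡ map (t ^_) (upTo m)) × IsTFree n t S × length S ≡ m)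
    × ((t n k : ℕ) → 2 ≤ t → 2 ≤ n → IsFloorLog t (n ∸ 1) k → sZn≥ n t k)
proposition10 = powers-freeSet , floorLog-freeSet
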